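{- For every positive integer $m$, $N^1_2(m)=m-1$.
   Context: An $\mathrm{ADS}^s_k(m)$-sequence is a sequence that is a concatenation of $m$ blocks, each block containing only distinct symbols, in which every symbol appears at least $k$ times, and which contains no (not necessarily contiguous) alternation $a\,b\,a\,b\ldots$ of length $s+2$ with $a\ne b$ (adjacent equal symbols at block interfaces are allowed). $N^s_k(m)$ is the maximum number of distinct symbols in an $\mathrm{ADS}^s_k(m)$-sequence. In particular, $\mathrm{ADS}^1_2(m)$-sequences contain no pattern $a\,b\,a$. -}

module Defs where

open import Data.Nat using (ℕ; zero; suc; _≤_; _≟_)
open import Data.List using (List; []; _∷_; concat; length; filter; deduplicate)
open import Data.List.Relation.Unary.All using (All)
open import Data.List.Relation.Unary.Unique.Propositional using (Unique)
open import Data.List.Membership.Propositional using (_∈_)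
open import Data.List.Relation.Binary.Sublist.Propositional using (_⊆_)
open import Data.Product using (_×_; Σ)
open import Relation.Nullary using (¬_)
open import Relation.Binary.PropositionalEquality using (_≡_; _≢_)

Blocks : Set
Blocks = List (List ℕ)

flat : Blocks → List ℕ
flat bs = concat bs

occ : ℕ → List ℕ → ℕ
occ x xs = length (filter (_≟ x) xs)

distinctSymbols : List ℕ → ℕ
distinctSymbols xs = length (deduplicate _≟_ xs)

alt : ℕ → ℕ → ℕ → List ℕ
alt a b zero    = []
alt a b (suc n) = a ∷ alt b a n

record IsADS (s k m : ℕ) (bs : Blocks) : Set where
  field
    numBlocks   : length bs ≡ m
    blocksDist  : All Unique bs
    occAtLeastK : ∀ x → x ∈ flat bs → k ≤ occ x (flat bs)
    noAlt       : ∀ a b → a ≢ b → ¬ (alt a b (suc (suc s)) ⊆ flat bs)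

IsN : (s k m n : ℕ) → Set
IsN s k m n =
  (Σ Blocks λ bs → IsADS s k m bs × distinctSymbols (flat bs) ≡ n)
  × (∀ bs → IsADS s k m bs → distinctSymbols (flat bs) ≤ n)

module Submission where

-- Call an adjacent pair of equal entries a stutter.  Inside a
-- block there is no stutter, so a concatenation of m blocks has at most
-- m - 1 stutters.  On the other hand, in an aba-free sequence all
-- occurrences of a symbol are consecutive, so a symbol occurring twice
-- contributes a stutter of its own; hence #symbols ≤ #stutters.
--
-- The "staircase" blocks [n-1] [n-1,n-2] … [1,0] [0] flatten
-- to the doubled descending list (n-1)(n-1)…00: it is sorted, hence
-- aba-free, every symbol occurs twice, and it has n distinct symbols.

open import Defs
open import Data.Nat using (ℕ; zero; suc; _≤_; _≥_; _>_; _∸_; _≟_; z≤n; s≤s; s≤s⁻¹)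
open import Data.Nat.Properties
  using (≤-refl; ≤-trans; ≤-reflexive; ≤-antisym; n≤1+n; m≤n⇒m≤1+n; <⇒≤; >⇒≢; 1+n≢n; module ≤-Reasoning)
open import Data.List using (List; []; _∷_; _++_; concat; length; deduplicate; downFrom)
open import Data.List.Properties
  using (filter-accept; filter-reject; filter-idem; filter-all; length-filter; ++-identityʳ; length-downFrom)
open import Data.List.Relation.Unary.All using (All; []; _∷_)
import Data.List.Relation.Unary.All.Properties as All
open import Data.List.Relation.Unary.Any using (here; there)
open import Data.List.Relation.Unary.AllPairs using (AllPairs; []; _∷_)
import Data.List.Relation.Unary.AllPairs as AllPairs
import Data.List.Relation.Unary.AllPairs.Properties as AllPairs
open import Data.List.Relation.Unary.Unique.Propositional using (Unique)
open import Data.List.Membership.Propositional using (_∈_)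
open import Data.List.Relation.Binary.Sublist.Propositional using (_⊆_; []; _∷_; _∷ʳ_; from∈)
open import Data.List.Relation.Binary.Sublist.Propositional.Properties using (All-resp-⊆)
open import Data.Product using (Σ; _×_; _,_; proj₁; proj₂)
open import Data.Empty using (⊥-elim)
open import Relation.Nullary using (¬_; Dec; yes; no; ¬?; contradiction)
open import Relation.Nullary.Decidable using (toSum)
open import Data.Sum using (inj₁; inj₂)
open import Relation.Binary.Core using (Rel)
open import Level using (0ℓ)
open import Relation.Binary.Definitions using (Reflexive)
open import Relation.Binary.PropositionalEquality
  using (_≡_; _≢_; refl; sym; trans; cong; subst; subst₂; module ≡-Reasoning)
open import Function using (_∘_)

occ-here : ∀ x t → occ x (x ∷ t) ≡ suc (occ x t)
occ-here x t = cong length (filter-accept (_≟ x) {x} {t} refl)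

occ-other : ∀ {x y} t → y ≢ x → occ x (y ∷ t) ≡ occ x t
occ-other {x} {y} t y≢x = cong length (filter-reject (_≟ x) {y} {t} y≢x)

occ-cons : ∀ x y t → occ x t ≤ occ x (y ∷ t)
occ-cons x y t with y ≟ x
... | yes refl = ≤-trans (n≤1+n _) (≤-reflexive (sym (occ-here y t)))
... | no y≢x   = ≤-reflexive (sym (occ-other t y≢x))

occ⇒∈ : ∀ x t → 1 ≤ occ x t → x ∈ t
occ⇒∈ x (y ∷ t) h with y ≟ x
... | yes refl = here refl
... | no y≢x   = there (occ⇒∈ x t (subst (1 ≤_) (occ-other t y≢x) h))

occurs-again : ∀ x t → 2 ≤ occ x (x ∷ t) → x ∈ t
occurs-again x t h = occ⇒∈ x t (s≤s⁻¹ (subst (2 ≤_) (occ-here x t) h))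

distinct-dup : ∀ x t → distinctSymbols (x ∷ x ∷ t) ≡ distinctSymbols (x ∷ t)
distinct-dup x t = cong (suc ∘ length)
  (trans (filter-reject new? {x} (λ x≢x → x≢x refl)) (filter-idem new? (deduplicate _≟_ t)))
  where
  new? : ∀ y → Dec (x ≢ y)
  new? = ¬? ∘ (x ≟_)

distinct-cons : ∀ x t → distinctSymbols (x ∷ t) ≤ suc (distinctSymbols t)
distinct-cons x t = s≤s (length-filter (¬? ∘ (x ≟_)) (deduplicate _≟_ t))

distinct-fresh : ∀ x t → All (x ≢_) t → distinctSymbols (x ∷ t) ≡ suc (distinctSymbols t)
distinct-fresh x t fresh =
  cong (suc ∘ length) (filter-all (¬? ∘ (x ≟_)) (All.deduplicate⁺ _≟_ fresh))

stuttersFrom : ℕ → List ℕ → ℕ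
stuttersFrom x []      = 0
stuttersFrom x (y ∷ t) with x ≟ y
... | yes _ = suc (stuttersFrom y t)
... | no  _ = stuttersFrom y t

stutters : List ℕ → ℕ
stutters []      = 0
stutters (x ∷ t) = stuttersFrom x t

stutters-same : ∀ x t → stutters (x ∷ x ∷ t) ≡ suc (stutters (x ∷ t))
stutters-same x t with x ≟ x
... | yes _   = refl
... | no x≢x = ⊥-elim (x≢x refl)

stutters-differ : ∀ {x y} t → x ≢ y → stutters (x ∷ y ∷ t) ≡ stutters (y ∷ t)
stutters-differ {x} {y} t x≢y with x ≟ y
... | yes x≡y = ⊥-elim (x≢y x≡y)
... | no _    = refl

stutters-unique : ∀ b → Unique b → stutters b ≡ 0
stutters-unique []          _                 = refl
stutters-unique (x ∷ [])    _                 = refl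
stutters-unique (x ∷ y ∷ b) ((x≢y ∷ _) ∷ u) =
  trans (stutters-differ b x≢y) (stutters-unique (y ∷ b) u)

-- Gluing a block of distinct symbols in front creates at most one stutter,
-- namely at the interface.
stutters-++ : ∀ b c → Unique b → stutters (b ++ c) ≤ suc (stutters c)
stutters-++ []          c       _                 = n≤1+n _
stutters-++ (x ∷ [])    []      _                 = z≤n
stutters-++ (x ∷ [])    (y ∷ c) _ with x ≟ y
... | yes _ = ≤-refl
... | no  _ = n≤1+n _
stutters-++ (x ∷ y ∷ b) c       ((x≢y ∷ _) ∷ u) =
  subst (_≤ suc (stutters c)) (sym (stutters-differ (b ++ c) x≢y)) (stutters-++ (y ∷ b) c u)

stutters-concat : ∀ bs → All Unique bs → stutters (concat bs) ≤ length bs ∸ 1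
stutters-concat []           []      = z≤n
stutters-concat (b ∷ [])     (u ∷ _) =
  ≤-reflexive (trans (cong stutters (++-identityʳ b)) (stutters-unique b u))
stutters-concat (b ∷ c ∷ bs) (u ∷ us) =
  ≤-trans (stutters-++ b (concat (c ∷ bs)) u) (s≤s (stutters-concat (c ∷ bs) us))

AbaFree : List ℕ → Set
AbaFree xs = ∀ a b → a ≢ b → ¬ ((a ∷ b ∷ a ∷ []) ⊆ xs)

aba-tail : ∀ {x t} → AbaFree (x ∷ t) → AbaFree t
aba-tail {x} free a b a≢b aba = free a b a≢b (x ∷ʳ aba)

aba-no-return : ∀ {x y t} → AbaFree (x ∷ y ∷ t) → x ≢ y → ¬ (x ∈ y ∷ t)
aba-no-return free x≢y (here x≡y) = x≢y x≡y
aba-no-return free x≢y (there x∈t) = free _ _ x≢y (refl ∷ refl ∷ from∈ x∈t)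

OthersRepeat : ℕ → List ℕ → Set
OthersRepeat x xs = ∀ y → y ≢ x → y ∈ xs → 2 ≤ occ y xs

others-tail : ∀ {x z t} → OthersRepeat x (x ∷ t) → z ≢ x → z ∈ t → 2 ≤ occ z t
others-tail {x} {z} {t} rep z≢x z∈t =
  subst (2 ≤_) (occ-other t (z≢x ∘ sym)) (rep z z≢x (there z∈t))

run-bound : ∀ x t → AbaFree (x ∷ t) → OthersRepeat x (x ∷ t) →
            distinctSymbols (x ∷ t) ≤ suc (stutters (x ∷ t))
          × (2 ≤ occ x (x ∷ t) → distinctSymbols (x ∷ t) ≤ stutters (x ∷ t))
run-bound x [] _ _ = s≤s z≤n , λ twice → contradiction (occurs-again x [] twice) λ ()
run-bound x (y ∷ t) free rep with toSum (x ≟ y)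
... | inj₁ refl = m≤n⇒m≤1+n repeated , λ _ → repeated
  where
  rep′ : OthersRepeat x (x ∷ t)
  rep′ z = others-tail rep
  repeated : distinctSymbols (x ∷ x ∷ t) ≤ stutters (x ∷ x ∷ t)
  repeated = subst₂ _≤_ (sym (distinct-dup x t)) (sym (stutters-same x t))
                    (proj₁ (run-bound x t (aba-tail free) rep′))
... | inj₂ x≢y = single , λ twice → ⊥-elim (aba-no-return free x≢y (occurs-again x (y ∷ t) twice))
  where
  y-repeats : 2 ≤ occ y (y ∷ t)
  y-repeats = others-tail rep (x≢y ∘ sym) (here refl)
  rep′ : OthersRepeat y (y ∷ t)
  rep′ z z≢y z∈ with z ≟ x
  ... | yes refl = ⊥-elim (aba-no-return free x≢y z∈)
  ... | no z≢x   = others-tail rep z≢x z∈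
  single : distinctSymbols (x ∷ y ∷ t) ≤ suc (stutters (x ∷ y ∷ t))
  single = ≤-trans (distinct-cons x (y ∷ t))
             (s≤s (subst (_ ≤_) (sym (stutters-differ t x≢y))
                    (proj₂ (run-bound y t (aba-tail free) rep′) y-repeats)))

symbols≤stutters : ∀ xs → AbaFree xs → (∀ y → y ∈ xs → 2 ≤ occ y xs) →
                   distinctSymbols xs ≤ stutters xs
symbols≤stutters []      _    _   = z≤n
symbols≤stutters (x ∷ t) free rep =
  proj₂ (run-bound x t free (λ y _ → rep y)) (rep x (here refl))

upper-bound : ∀ m bs → IsADS 1 2 m bs → distinctSymbols (flat bs) ≤ m ∸ 1
upper-bound m bs ads = begin
  distinctSymbols (flat bs)  ≤⟨ symbols≤stutters (flat bs) noAlt occAtLeastK ⟩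
  stutters (concat bs)       ≤⟨ stutters-concat bs blocksDist ⟩
  length bs ∸ 1              ≡⟨ cong (_∸ 1) numBlocks ⟩
  m ∸ 1                      ∎
  where
  open IsADS ads
  open ≤-Reasoning

double : List ℕ → List ℕ
double []      = []
double (x ∷ t) = x ∷ x ∷ double t

double-All : ∀ {P : ℕ → Set} {xs} → All P xs → All P (double xs)
double-All []         = []
double-All (px ∷ pxs) = px ∷ px ∷ double-All pxs

double-AllPairs : ∀ {R : Rel ℕ 0ℓ} {xs} → Reflexive R → AllPairs R xs → AllPairs R (double xs)
double-AllPairs refl-R []           = []
double-AllPairs refl-R (rx ∷ pairs) =
  (refl-R ∷ double-All rx) ∷ double-All rx ∷ double-AllPairs refl-R pairs

occ-double : ∀ xs {x} → x ∈ double xs → 2 ≤ occ x (double xs)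
occ-double (y ∷ ys)     (here refl)         = twice-head y (double ys)
  where
  twice-head : ∀ y t → 2 ≤ occ y (y ∷ y ∷ t)
  twice-head y t rewrite occ-here y (y ∷ t) | occ-here y t = s≤s (s≤s z≤n)
occ-double (y ∷ ys)     (there (here refl)) = occ-double (y ∷ ys) (here refl)
occ-double (y ∷ ys) {x} (there (there x∈)) = begin
  2                            ≤⟨ occ-double ys x∈ ⟩
  occ x (double ys)            ≤⟨ occ-cons x y (double ys) ⟩
  occ x (y ∷ double ys)        ≤⟨ occ-cons x y (y ∷ double ys) ⟩
  occ x (double (y ∷ ys))      ∎
  where open ≤-Reasoning

distinct-double : ∀ xs → Unique xs → distinctSymbols (double xs) ≡ length xs
distinct-double []      []           = refl
distinct-double (x ∷ t) (fresh ∷ u) = begin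
  distinctSymbols (x ∷ x ∷ double t)  ≡⟨ distinct-dup x (double t) ⟩
  distinctSymbols (x ∷ double t)      ≡⟨ distinct-fresh x (double t) (double-All fresh) ⟩
  suc (distinctSymbols (double t))    ≡⟨ cong suc (distinct-double t u) ⟩
  suc (length t)                      ∎
  where open ≡-Reasoning

sublist-AllPairs : ∀ {R : Rel ℕ 0ℓ} {xs ys} → ys ⊆ xs → AllPairs R xs → AllPairs R ys
sublist-AllPairs []        []          = []
sublist-AllPairs (y ∷ʳ σ)  (_ ∷ pairs) = sublist-AllPairs σ pairs
sublist-AllPairs (refl ∷ σ) (r ∷ pairs) = All-resp-⊆ σ r ∷ sublist-AllPairs σ pairs

descending-abaFree : ∀ {xs} → AllPairs _≥_ xs → AbaFree xs
descending-abaFree sorted a b a≢b aba with sublist-AllPairs aba sorted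
... | (a≥b ∷ _) ∷ (b≥a ∷ []) ∷ _ = a≢b (≤-antisym b≥a a≥b)

downFrom-descending : ∀ n → AllPairs _>_ (downFrom n)
downFrom-descending n = AllPairs.applyDownFrom⁺₁ (λ i → i) n (λ j<i _ → j<i)

doubled-isADS : ∀ bs xs → flat bs ≡ double xs → AllPairs _>_ xs → All Unique bs →
                IsADS 1 2 (length bs) bs
doubled-isADS bs xs flat≡ descending unique = record
  { numBlocks   = refl
  ; blocksDist  = unique
  ; occAtLeastK = λ x x∈ →
      subst (λ s → 2 ≤ occ x s) (sym flat≡) (occ-double xs (subst (x ∈_) flat≡ x∈))
  ; noAlt       = λ a b a≢b aba →
      descending-abaFree sorted a b a≢b (subst (_ ⊆_) flat≡ aba)
  }
  where
  sorted : AllPairs _≥_ (double xs)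
  sorted = double-AllPairs ≤-refl (AllPairs.map <⇒≤ descending)

ladder : ℕ → Blocks
ladder zero    = (0 ∷ []) ∷ []
ladder (suc k) = (suc k ∷ k ∷ []) ∷ ladder k

staircase : ℕ → Blocks
staircase zero    = [] ∷ []
staircase (suc k) = (k ∷ []) ∷ ladder k

flat-ladder : ∀ k → flat (ladder k) ≡ k ∷ double (downFrom k)
flat-ladder zero    = refl
flat-ladder (suc k) = cong (λ s → suc k ∷ k ∷ s) (flat-ladder k)

flat-staircase : ∀ n → flat (staircase n) ≡ double (downFrom n)
flat-staircase zero    = refl
flat-staircase (suc k) = cong (k ∷_) (flat-ladder k)

length-ladder : ∀ k → length (ladder k) ≡ suc k
length-ladder zero    = refl
length-ladder (suc k) = cong suc (length-ladder k)

length-staircase : ∀ n → length (staircase n) ≡ suc n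
length-staircase zero    = refl
length-staircase (suc k) = cong suc (length-ladder k)

ladder-unique : ∀ k → All Unique (ladder k)
ladder-unique zero    = ([] ∷ []) ∷ []
ladder-unique (suc k) = ((1+n≢n ∷ []) ∷ [] ∷ []) ∷ ladder-unique k

staircase-unique : ∀ n → All Unique (staircase n)
staircase-unique zero    = [] ∷ []
staircase-unique (suc k) = ([] ∷ []) ∷ ladder-unique k

lower-bound : ∀ n → Σ Blocks λ bs → IsADS 1 2 (suc n) bs × distinctSymbols (flat bs) ≡ n
lower-bound n = staircase n , isADS , symbols
  where
  isADS : IsADS 1 2 (suc n) (staircase n)
  isADS = subst (λ m → IsADS 1 2 m (staircase n)) (length-staircase n)
            (doubled-isADS (staircase n) (downFrom n) (flat-staircase n)
               (downFrom-descending n) (staircase-unique n))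
  symbols : distinctSymbols (flat (staircase n)) ≡ n
  symbols = begin
    distinctSymbols (flat (staircase n))     ≡⟨ cong distinctSymbols (flat-staircase n) ⟩
    distinctSymbols (double (downFrom n))    ≡⟨ distinct-double (downFrom n)
                                                  (AllPairs.map >⇒≢ (downFrom-descending n)) ⟩
    length (downFrom n)                      ≡⟨ length-downFrom n ⟩
    n                                        ∎
    where open ≡-Reasoning

lemma4p3 : (m : ℕ) → 1 ≤ m → IsN 1 2 m (m ∸ 1)
lemma4p3 zero    ()
lemma4p3 (suc n) _  = lower-bound n , upper-bound (suc n)
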